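{- The Riordan array $(1,\ x(1+x)^2)$ has vertical half $$V=\left(\frac{1}{\sqrt{1-4x}},\ xc(x)^2\right)$$ and horizontal half $$H=\left(\frac{1}{\sqrt{1-4x}},\ xc(x)^4\right).$$
   Context: All power series are formal power series with complex coefficients. A Riordan array is a pair $(g(x),f(x))$ of power series with $g(0)\neq 0$, $f(0)=0$, $f'(0)\neq 0$; it is identified with the infinite lower triangular matrix $(t_{n,k})_{n,k\ge 0}$, $t_{n,k}=[x^n]g(x)f(x)^k$. The vertical half of a Riordan array with matrix $(t_{n,k})$ is the matrix whose $(n,k)$ entry is $t_{2n-k,n}$ (with $t_{i,j}=0$ for $j>i$); the horizontal half is the matrix whose $(n,k)$ entry is $t_{2n,n+k}$. Here $c(x)=\frac{1-\sqrt{1-4x}}{2x}$ is the generating function of the Catalan numbers. -}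

module Defs where

open import Data.Nat using (ℕ; zero; suc; _∸_; _≤ᵇ_)
open import Data.Integer using (ℤ; +_; _+_; _*_; -_)
open import Data.Bool using (if_then_else_)
open import Relation.Binary.PropositionalEquality using (_≡_)

-- Formal power series with integer coefficients: n ↦ [x^n] f.
infixl 6 _⊕_
infixl 7 _⊛_
infixr 8 _^ˢ_
infix 4 _≈ˢ_

PS : Set
PS = ℕ → ℤ

sumTo : ℕ → (ℕ → ℤ) → ℤ
sumTo zero    h = h zero
sumTo (suc n) h = sumTo n h + h (suc n)

_⊕_ : PS → PS → PS
(f ⊕ g) n = f n + g n

_⊛_ : PS → PS → PS
(f ⊛ g) n = sumTo n (λ i → f i * g (n ∸ i))

const : ℤ → PS
const c zero    = c
const c (suc n) = + 0

one : PS
one = const (+ 1)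

X : PS
X (suc zero) = + 1
X _          = + 0

_^ˢ_ : PS → ℕ → PS
f ^ˢ zero  = one
f ^ˢ suc k = f ⊛ (f ^ˢ k)

_≈ˢ_ : PS → PS → Set
f ≈ˢ g = ∀ n → f n ≡ g n

riordan : PS → PS → ℕ → ℕ → ℤ
riordan g f n k = if k ≤ᵇ n then (g ⊛ (f ^ˢ k)) n else + 0

-- Vertical half: (n,k) ↦ t_{2n-k, n}  (zero when 2n - k is negative).
verticalHalf : (ℕ → ℕ → ℤ) → ℕ → ℕ → ℤ
verticalHalf t n k = if k ≤ᵇ (n Data.Nat.+ n) then t ((n Data.Nat.+ n) ∸ k) n else + 0

horizontalHalf : (ℕ → ℕ → ℤ) → ℕ → ℕ → ℤ
horizontalHalf t n k = t (n Data.Nat.+ n) (n Data.Nat.+ k)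

oneMinus4x : PS
oneMinus4x = one ⊕ (const (- (+ 4)) ⊛ X)

x1px2 : PS
x1px2 = X ⊛ ((one ⊕ X) ^ˢ 2)

-- The entries of (1, x(1+x)²) are t(n,k) = C(2k, n-k).  For s = 1/√(1-4x) and
-- the Catalan series c, the identity xc = x + (xc)² gives (1 - 2xc)² = 1 - 4x, so
-- s(1 - 2xc) = 1, i.e. s = 1 + 2xsc.  Together with c = 1 + xc² this yields a
-- recurrence for the coefficients [x^n] s c^m that C(2n+m, n) also satisfies,
-- hence (s, x c^m) has entries C(2(n-k) + mk, n-k).  For m = 2 and m = 4 these are
-- exactly the entries C(2n, n-k) and C(2n+2k, n-k) of the two halves.
module Submission where

open import Algebra.Bundles using (CommutativeMonoid)
import Algebra.Properties.CommutativeMonoid.Mult as CommutativeMonoidMult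
import Algebra.Properties.CommutativeSemigroup as CommutativeSemigroupProperties
open import Data.Bool using (true; false; if_then_else_)
open import Data.Integer using (ℤ; +_; _+_; _*_; -_)
import Data.Integer.Properties as ℤP
open import Data.Integer.Tactic.RingSolver using (solve-∀)
open import Data.Nat.Combinatorics using (_C_; nCk+nC[k+1]≡[n+1]C[k+1]; nCk≡nC[n∸k])
open import Data.Nat as ℕ using (ℕ; zero; suc; _∸_; _≤_; _<_; z≤n; s≤s; _≤ᵇ_)
import Data.Nat.Properties as ℕP
import Data.Nat.Tactic.RingSolver as ℕSolver
open import Data.Nat.Induction using (<-rec)
open import Data.Product using (_×_; _,_)
open import Function using (_∘_)
open import Level using (0ℓ)
open import Relation.Binary.PropositionalEquality
open import Relation.Nullary using (¬_; contradiction; yes; no)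
open import Relation.Nullary.Reflects using (ofʸ; ofⁿ)

open import Defs

open ≡-Reasoning

module ℤ+ = CommutativeSemigroupProperties ℤP.+-commutativeSemigroup

sumTo-cong : ∀ n {h h′ : ℕ → ℤ} → (∀ i → i ≤ n → h i ≡ h′ i) → sumTo n h ≡ sumTo n h′
sumTo-cong zero    eq = eq 0 z≤n
sumTo-cong (suc n) eq =
  cong₂ _+_ (sumTo-cong n (λ i i≤n → eq i (ℕP.m≤n⇒m≤1+n i≤n))) (eq (suc n) ℕP.≤-refl)

sumTo-zero : ∀ n {h : ℕ → ℤ} → (∀ i → i ≤ n → h i ≡ + 0) → sumTo n h ≡ + 0
sumTo-zero zero    eq = eq 0 z≤n
sumTo-zero (suc n) eq =
  cong₂ _+_ (sumTo-zero n (λ i i≤n → eq i (ℕP.m≤n⇒m≤1+n i≤n))) (eq (suc n) ℕP.≤-refl)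

sumTo-head : ∀ n {h : ℕ → ℤ} → (∀ i → h (suc i) ≡ + 0) → sumTo n h ≡ h 0
sumTo-head zero    _  = refl
sumTo-head (suc n) eq = trans (cong₂ _+_ (sumTo-head n eq) (eq n)) (ℤP.+-identityʳ _)

sumTo-last : ∀ n {h : ℕ → ℤ} → (∀ i → i < n → h i ≡ + 0) → sumTo n h ≡ h n
sumTo-last zero    _  = refl
sumTo-last (suc n) {h} eq =
  trans (cong (_+ h (suc n)) (sumTo-zero n (λ i i≤n → eq i (s≤s i≤n)))) (ℤP.+-identityˡ _)

sumTo-suc : ∀ n (h : ℕ → ℤ) → sumTo (suc n) h ≡ h 0 + sumTo n (h ∘ suc)
sumTo-suc zero    h = refl
sumTo-suc (suc n) h = begin
  sumTo (suc n) h + h (suc (suc n))            ≡⟨ cong (_+ h (suc (suc n))) (sumTo-suc n h) ⟩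
  h 0 + sumTo n (h ∘ suc) + h (suc (suc n))    ≡⟨ ℤP.+-assoc (h 0) _ _ ⟩
  h 0 + (sumTo n (h ∘ suc) + h (suc (suc n)))  ∎

sumTo-+ : ∀ n (h k : ℕ → ℤ) → sumTo n (λ i → h i + k i) ≡ sumTo n h + sumTo n k
sumTo-+ zero    h k = refl
sumTo-+ (suc n) h k = trans (cong (_+ (h (suc n) + k (suc n))) (sumTo-+ n h k))
  (ℤ+.interchange (sumTo n h) (sumTo n k) _ _)

sumTo-*ˡ : ∀ n a (h : ℕ → ℤ) → sumTo n (λ i → a * h i) ≡ a * sumTo n h
sumTo-*ˡ zero    a h = refl
sumTo-*ˡ (suc n) a h = trans (cong (_+ (a * h (suc n))) (sumTo-*ˡ n a h))
  (sym (ℤP.*-distribˡ-+ a (sumTo n h) _))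

sumTo-*ʳ : ∀ n a (h : ℕ → ℤ) → sumTo n (λ i → h i * a) ≡ sumTo n h * a
sumTo-*ʳ zero    a h = refl
sumTo-*ʳ (suc n) a h = trans (cong (_+ (h (suc n) * a)) (sumTo-*ʳ n a h))
  (sym (ℤP.*-distribʳ-+ a (sumTo n h) _))

sumTo-reverse : ∀ n (h : ℕ → ℤ) → sumTo n h ≡ sumTo n (λ i → h (n ∸ i))
sumTo-reverse zero    h = refl
sumTo-reverse (suc n) h = begin
  sumTo n h + h (suc n)                   ≡⟨ ℤP.+-comm (sumTo n h) _ ⟩
  h (suc n) + sumTo n h                   ≡⟨ cong (λ t → h (suc n) + t) (sumTo-reverse n h) ⟩
  h (suc n) + sumTo n (λ i → h (n ∸ i))   ≡⟨ sym (sumTo-suc n (λ i → h (suc n ∸ i))) ⟩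
  sumTo (suc n) (λ i → h (suc n ∸ i))     ∎

sumTo-triangle : ∀ n (F : ℕ → ℕ → ℤ) →
  sumTo n (λ k → sumTo k (λ i → F i k)) ≡ sumTo n (λ i → sumTo (n ∸ i) (λ j → F i (i ℕ.+ j)))
sumTo-triangle zero    F = refl
sumTo-triangle (suc n) F = begin
  sumTo n (λ k → sumTo k (λ i → F i k)) + sumTo (suc n) (λ i → F i (suc n))
    ≡⟨ cong (_+ sumTo (suc n) (λ i → F i (suc n))) (sumTo-triangle n F) ⟩
  R + (sumTo n (λ i → F i (suc n)) + F (suc n) (suc n))
    ≡⟨ sym (ℤP.+-assoc R _ _) ⟩
  R + sumTo n (λ i → F i (suc n)) + F (suc n) (suc n)
    ≡⟨ cong₂ _+_ (sym (sumTo-+ n _ _)) (sym diagonal) ⟩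
  sumTo n (λ i → sumTo (n ∸ i) (λ j → F i (i ℕ.+ j)) + F i (suc n)) + sumTo (n ∸ n) (G (suc n))
    ≡⟨ cong (_+ sumTo (n ∸ n) (G (suc n))) (sumTo-cong n row) ⟩
  sumTo n (λ i → sumTo (suc n ∸ i) (G i)) + sumTo (n ∸ n) (G (suc n))
    ∎
  where
  G : ℕ → ℕ → ℤ
  G i j = F i (i ℕ.+ j)
  R = sumTo n (λ i → sumTo (n ∸ i) (G i))
  diagonal : sumTo (n ∸ n) (G (suc n)) ≡ F (suc n) (suc n)
  diagonal = trans (cong (λ m → sumTo m (G (suc n))) (ℕP.n∸n≡0 n))
                   (cong (F (suc n)) (ℕP.+-identityʳ (suc n)))
  row : ∀ i → i ≤ n → sumTo (n ∸ i) (G i) + F i (suc n) ≡ sumTo (suc n ∸ i) (G i)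
  row i i≤n = begin
    sumTo (n ∸ i) (G i) + F i (suc n)
      ≡⟨ cong (λ m → sumTo (n ∸ i) (G i) + F i m)
           (sym (trans (ℕP.+-suc i (n ∸ i)) (cong suc (ℕP.m+[n∸m]≡n i≤n)))) ⟩
    sumTo (suc (n ∸ i)) (G i)
      ≡⟨ cong (λ m → sumTo m (G i)) (sym (ℕP.+-∸-assoc 1 i≤n)) ⟩
    sumTo (suc n ∸ i) (G i) ∎

infix 4 _≋_

-- Coefficientwise equality, wrapped in a record so that both series can be
-- inferred from a proof of it.
record _≋_ (f g : PS) : Set where
  constructor coeffwise
  field at : f ≈ˢ g
open _≋_

≋-refl : ∀ {f} → f ≋ f
≋-refl = coeffwise λ _ → refl

≋-sym : ∀ {f g} → f ≋ g → g ≋ f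
≋-sym p = coeffwise λ n → sym (at p n)

≋-trans : ∀ {f g h} → f ≋ g → g ≋ h → f ≋ h
≋-trans p q = coeffwise λ n → trans (at p n) (at q n)

⊕-cong : ∀ {f f′ g g′} → f ≋ f′ → g ≋ g′ → f ⊕ g ≋ f′ ⊕ g′
⊕-cong p q = coeffwise λ n → cong₂ _+_ (at p n) (at q n)

⊛-cong : ∀ {f f′ g g′} → f ≋ f′ → g ≋ g′ → f ⊛ g ≋ f′ ⊛ g′
⊛-cong p q = coeffwise λ n → sumTo-cong n (λ i _ → cong₂ _*_ (at p i) (at q (n ∸ i)))

⊛-comm : ∀ f g → f ⊛ g ≋ g ⊛ f
⊛-comm f g = coeffwise λ n → begin
  sumTo n (λ i → f i * g (n ∸ i))              ≡⟨ sumTo-reverse n _ ⟩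
  sumTo n (λ i → f (n ∸ i) * g (n ∸ (n ∸ i)))  ≡⟨ sumTo-cong n (swap n) ⟩
  sumTo n (λ i → g i * f (n ∸ i))              ∎
  where
  swap : ∀ n i → i ≤ n → f (n ∸ i) * g (n ∸ (n ∸ i)) ≡ g i * f (n ∸ i)
  swap n i i≤n = trans (cong (λ j → f (n ∸ i) * g j) (ℕP.m∸[m∸n]≡n i≤n)) (ℤP.*-comm (f (n ∸ i)) (g i))

⊛-assoc : ∀ f g h → (f ⊛ g) ⊛ h ≋ f ⊛ (g ⊛ h)
⊛-assoc f g h = coeffwise λ n → begin
  sumTo n (λ k → sumTo k (λ i → f i * g (k ∸ i)) * h (n ∸ k))
    ≡⟨ sumTo-cong n (λ k _ → sym (sumTo-*ʳ k (h (n ∸ k)) (λ i → f i * g (k ∸ i)))) ⟩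
  sumTo n (λ k → sumTo k (λ i → f i * g (k ∸ i) * h (n ∸ k)))
    ≡⟨ sumTo-triangle n (λ i k → f i * g (k ∸ i) * h (n ∸ k)) ⟩
  sumTo n (λ i → sumTo (n ∸ i) (λ j → f i * g (i ℕ.+ j ∸ i) * h (n ∸ (i ℕ.+ j))))
    ≡⟨ sumTo-cong n (λ i _ → trans (sumTo-cong (n ∸ i) (λ j _ → reindex n i j))
                                   (sumTo-*ˡ (n ∸ i) (f i) (λ j → g j * h (n ∸ i ∸ j)))) ⟩
  sumTo n (λ i → f i * sumTo (n ∸ i) (λ j → g j * h (n ∸ i ∸ j)))
    ∎
  where
  reindex : ∀ n i j → f i * g (i ℕ.+ j ∸ i) * h (n ∸ (i ℕ.+ j)) ≡ f i * (g j * h (n ∸ i ∸ j))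
  reindex n i j = trans (cong₂ (λ a b → f i * g a * h b) (ℕP.m+n∸m≡n i j) (sym (ℕP.∸-+-assoc n i j)))
                        (ℤP.*-assoc (f i) (g j) _)

const-⊛ : ∀ a f n → (const a ⊛ f) n ≡ a * f n
const-⊛ a f n = sumTo-head n (λ _ → refl)

⊛-identityˡ : ∀ f → one ⊛ f ≋ f
⊛-identityˡ f = coeffwise λ n → trans (const-⊛ (+ 1) f n) (ℤP.*-identityˡ (f n))

⊛-identityʳ : ∀ f → f ⊛ one ≋ f
⊛-identityʳ f = ≋-trans (⊛-comm f one) (⊛-identityˡ f)

⊛-distribˡ-⊕ : ∀ f g h → f ⊛ (g ⊕ h) ≋ f ⊛ g ⊕ f ⊛ h
⊛-distribˡ-⊕ f g h = coeffwise λ n →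
  trans (sumTo-cong n (λ i _ → ℤP.*-distribˡ-+ (f i) (g (n ∸ i)) (h (n ∸ i)))) (sumTo-+ n _ _)

⊛-distribʳ-⊕ : ∀ f g h → (g ⊕ h) ⊛ f ≋ g ⊛ f ⊕ h ⊛ f
⊛-distribʳ-⊕ f g h = ≋-trans (⊛-comm (g ⊕ h) f)
  (≋-trans (⊛-distribˡ-⊕ f g h) (⊕-cong (⊛-comm f g) (⊛-comm f h)))

⊛-commutativeMonoid : CommutativeMonoid 0ℓ 0ℓ
⊛-commutativeMonoid = record
  { Carrier = PS
  ; _≈_ = _≋_
  ; _∙_ = _⊛_
  ; ε = one
  ; isCommutativeMonoid = record
    { isMonoid = record
      { isSemigroup = record
        { isMagma = record
          { isEquivalence = record { refl = ≋-refl ; sym = ≋-sym ; trans = ≋-trans }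
          ; ∙-cong = ⊛-cong
          }
        ; assoc = ⊛-assoc
        }
      ; identity = ⊛-identityˡ , ⊛-identityʳ
      }
    ; comm = ⊛-comm
    }
  }

open CommutativeMonoid ⊛-commutativeMonoid
  using () renaming (∙-congˡ to ⊛-congˡ; ∙-congʳ to ⊛-congʳ)
open CommutativeSemigroupProperties (CommutativeMonoid.commutativeSemigroup ⊛-commutativeMonoid)
  using (x∙yz≈y∙xz; interchange)
open CommutativeMonoidMult ⊛-commutativeMonoid
  using (×-assocˡ; ×-distrib-+) renaming (_×_ to _times_)

^ˢ≡times : ∀ f k → f ^ˢ k ≡ k times f
^ˢ≡times f zero    = refl
^ˢ≡times f (suc k) = cong (f ⊛_) (^ˢ≡times f k)

^ˢ-^ˢ : ∀ f m k → (f ^ˢ m) ^ˢ k ≋ f ^ˢ (k ℕ.* m)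
^ˢ-^ˢ f m k rewrite ^ˢ≡times (f ^ˢ m) k | ^ˢ≡times f m | ^ˢ≡times f (k ℕ.* m) = ×-assocˡ f k m

⊛-^ˢ : ∀ f g k → (f ⊛ g) ^ˢ k ≋ f ^ˢ k ⊛ g ^ˢ k
⊛-^ˢ f g k rewrite ^ˢ≡times (f ⊛ g) k | ^ˢ≡times f k | ^ˢ≡times g k = ×-distrib-+ f g k

X⊛-suc : ∀ f n → (X ⊛ f) (suc n) ≡ f n
X⊛-suc f n = begin
  (X ⊛ f) (suc n)                                 ≡⟨ sumTo-suc n _ ⟩
  + 0 + sumTo n (λ i → X (suc i) * f (n ∸ i))     ≡⟨ ℤP.+-identityˡ _ ⟩
  sumTo n (λ i → X (suc i) * f (n ∸ i))           ≡⟨ sumTo-head n (λ _ → refl) ⟩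
  + 1 * f n                                       ≡⟨ ℤP.*-identityˡ (f n) ⟩
  f n                                             ∎

X^ˢ⊛-+ : ∀ k f n → (X ^ˢ k ⊛ f) (k ℕ.+ n) ≡ f n
X^ˢ⊛-+ zero    f n = at (⊛-identityˡ f) n
X^ˢ⊛-+ (suc k) f n = begin
  (X ^ˢ suc k ⊛ f) (suc k ℕ.+ n)  ≡⟨ at (⊛-assoc X (X ^ˢ k) f) (suc k ℕ.+ n) ⟩
  (X ⊛ (X ^ˢ k ⊛ f)) (suc k ℕ.+ n) ≡⟨ X⊛-suc (X ^ˢ k ⊛ f) (k ℕ.+ n) ⟩
  (X ^ˢ k ⊛ f) (k ℕ.+ n)           ≡⟨ X^ˢ⊛-+ k f n ⟩
  f n                              ∎

if-≤ᵇ-true : ∀ {A : Set} {m n} {a b : A} → m ≤ n → (if m ≤ᵇ n then a else b) ≡ a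
if-≤ᵇ-true {m = m} {n} m≤n with m ≤ᵇ n | ℕP.≤ᵇ-reflects-≤ m n
... | true  | _        = refl
... | false | ofⁿ m≰n = contradiction m≤n m≰n

if-≤ᵇ-false : ∀ {A : Set} {m n} {a b : A} → ¬ m ≤ n → (if m ≤ᵇ n then a else b) ≡ b
if-≤ᵇ-false {m = m} {n} m≰n with m ≤ᵇ n | ℕP.≤ᵇ-reflects-≤ m n
... | true  | ofʸ m≤n = contradiction m≤n m≰n
... | false | _       = refl

riordan-X⊛ : ∀ g p {n k} → k ≤ n → riordan g (X ⊛ p) n k ≡ (g ⊛ p ^ˢ k) (n ∸ k)
riordan-X⊛ g p {n} {k} k≤n = begin
  riordan g (X ⊛ p) n k                   ≡⟨ if-≤ᵇ-true k≤n ⟩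
  (g ⊛ (X ⊛ p) ^ˢ k) n                    ≡⟨ at (⊛-congˡ {g} (⊛-^ˢ X p k)) n ⟩
  (g ⊛ (X ^ˢ k ⊛ p ^ˢ k)) n               ≡⟨ at (x∙yz≈y∙xz g (X ^ˢ k) (p ^ˢ k)) n ⟩
  (X ^ˢ k ⊛ (g ⊛ p ^ˢ k)) n               ≡⟨ cong (X ^ˢ k ⊛ (g ⊛ p ^ˢ k)) (sym (ℕP.m+[n∸m]≡n k≤n)) ⟩
  (X ^ˢ k ⊛ (g ⊛ p ^ˢ k)) (k ℕ.+ (n ∸ k)) ≡⟨ X^ˢ⊛-+ k (g ⊛ p ^ˢ k) (n ∸ k) ⟩
  (g ⊛ p ^ˢ k) (n ∸ k)                    ∎

[1+X]^ˢ-coeff : ∀ j i → ((one ⊕ X) ^ˢ j) i ≡ + (j C i)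
[1+X]^ˢ-coeff zero    zero    = refl
[1+X]^ˢ-coeff zero    (suc i) = refl
[1+X]^ˢ-coeff (suc j) i = begin
  ((one ⊕ X) ⊛ P) i          ≡⟨ at (⊛-distribʳ-⊕ P one X) i ⟩
  (one ⊛ P) i + (X ⊛ P) i    ≡⟨ cong (_+ (X ⊛ P) i) (at (⊛-identityˡ P) i) ⟩
  P i + (X ⊛ P) i            ≡⟨ pascal i ⟩
  + (suc j C i)              ∎
  where
  P = (one ⊕ X) ^ˢ j
  pascal : ∀ i → P i + (X ⊛ P) i ≡ + (suc j C i)
  pascal zero    = trans (ℤP.+-identityʳ (P 0)) ([1+X]^ˢ-coeff j 0)
  pascal (suc i) = begin
    P (suc i) + (X ⊛ P) (suc i)  ≡⟨ cong₂ _+_ ([1+X]^ˢ-coeff j (suc i)) (trans (X⊛-suc P i) ([1+X]^ˢ-coeff j i)) ⟩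
    + (j C suc i ℕ.+ j C i)      ≡⟨ cong +_ (trans (ℕP.+-comm (j C suc i) (j C i)) (nCk+nC[k+1]≡[n+1]C[k+1] j i)) ⟩
    + (suc j C suc i)            ∎

riordan-x[1+x]² : ∀ {n k} → k ≤ n → riordan one x1px2 n k ≡ + ((k ℕ.* 2) C (n ∸ k))
riordan-x[1+x]² {n} {k} k≤n = begin
  riordan one x1px2 n k              ≡⟨ riordan-X⊛ one P k≤n ⟩
  (one ⊛ P ^ˢ k) (n ∸ k)             ≡⟨ at (⊛-identityˡ (P ^ˢ k)) (n ∸ k) ⟩
  (P ^ˢ k) (n ∸ k)                   ≡⟨ at (^ˢ-^ˢ (one ⊕ X) 2 k) (n ∸ k) ⟩
  ((one ⊕ X) ^ˢ (k ℕ.* 2)) (n ∸ k)   ≡⟨ [1+X]^ˢ-coeff (k ℕ.* 2) (n ∸ k) ⟩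
  + ((k ℕ.* 2) C (n ∸ k))            ∎
  where P = (one ⊕ X) ^ˢ 2

square-root-of-one : ∀ w → w ⊛ w ≋ one → w 0 ≡ + 1 → w ≋ one
square-root-of-one w w²≋1 w₀≡1 = coeffwise λ { zero → w₀≡1 ; (suc n) → <-rec _ higher n }
  where
  higher : ∀ n → (∀ {i} → i < n → w (suc i) ≡ + 0) → w (suc n) ≡ + 0
  higher n ih = ℤP.*-cancelˡ-≡ (+ 2) x (+ 0) (begin
    + 2 * x                                           ≡⟨ double x ⟩
    + 1 * x + x * + 1                                 ≡⟨ cong₂ (λ a b → a * x + x * b) (sym w₀≡1) (sym wₙ∸ₙ≡1) ⟩
    w 0 * x + x * w (n ∸ n)                           ≡⟨ cong (λ t → w 0 * x + t) (sym (sumTo-last n middle≡0)) ⟩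
    w 0 * x + sumTo n (λ i → w (suc i) * w (n ∸ i))   ≡⟨ sym (sumTo-suc n _) ⟩
    (w ⊛ w) (suc n)                                   ≡⟨ at w²≋1 (suc n) ⟩
    + 0                                               ∎)
    where
    x = w (suc n)
    double : ∀ x → + 2 * x ≡ + 1 * x + x * + 1
    double = solve-∀
    wₙ∸ₙ≡1 : w (n ∸ n) ≡ + 1
    wₙ∸ₙ≡1 = trans (cong w (ℕP.n∸n≡0 n)) w₀≡1
    middle≡0 : ∀ i → i < n → w (suc i) * w (n ∸ i) ≡ + 0
    middle≡0 i i<n = cong (_* w (n ∸ i)) (ih i<n)

-- [x^n] c(x)^m / √(1 - 4x)
catalanPowerCoeff : ℕ → ℕ → ℕ
catalanPowerCoeff m n = (n ℕ.+ n ℕ.+ m) C n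

catalanPowerCoeff-0-suc : ∀ n → catalanPowerCoeff 0 (suc n) ≡ 2 ℕ.* catalanPowerCoeff 1 n
catalanPowerCoeff-0-suc n = begin
  (suc n ℕ.+ suc n ℕ.+ 0) C suc n  ≡⟨ cong (_C suc n) (2n+2≡1+N n) ⟩
  suc N C suc n                    ≡⟨ sym (nCk+nC[k+1]≡[n+1]C[k+1] N n) ⟩
  N C n ℕ.+ N C suc n              ≡⟨ cong (N C n ℕ.+_) symmetric ⟩
  N C n ℕ.+ N C n                  ≡⟨ x+x≡2x (N C n) ⟩
  2 ℕ.* (N C n)                    ∎
  where
  N = n ℕ.+ n ℕ.+ 1
  2n+2≡1+N : ∀ n → suc n ℕ.+ suc n ℕ.+ 0 ≡ suc (n ℕ.+ n ℕ.+ 1)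
  2n+2≡1+N = ℕSolver.solve-∀
  N≡1+n+n : ∀ n → n ℕ.+ n ℕ.+ 1 ≡ suc n ℕ.+ n
  N≡1+n+n = ℕSolver.solve-∀
  x+x≡2x : ∀ x → x ℕ.+ x ≡ 2 ℕ.* x
  x+x≡2x = ℕSolver.solve-∀
  symmetric : N C suc n ≡ N C n
  symmetric rewrite N≡1+n+n n =
    trans (nCk≡nC[n∸k] (ℕP.m≤m+n (suc n) n)) (cong ((suc n ℕ.+ n) C_) (ℕP.m+n∸m≡n (suc n) n))

catalanPowerCoeff-suc-suc : ∀ m n →
  catalanPowerCoeff (suc m) (suc n) ≡ catalanPowerCoeff m (suc n) ℕ.+ catalanPowerCoeff (suc (suc m)) n
catalanPowerCoeff-suc-suc m n = begin
  (suc n ℕ.+ suc n ℕ.+ suc m) C suc n  ≡⟨ cong (_C suc n) (ℕP.+-suc (suc n ℕ.+ suc n) m) ⟩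
  suc N C suc n                        ≡⟨ sym (nCk+nC[k+1]≡[n+1]C[k+1] N n) ⟩
  N C n ℕ.+ N C suc n                  ≡⟨ ℕP.+-comm (N C n) _ ⟩
  N C suc n ℕ.+ N C n                  ≡⟨ cong (λ t → N C suc n ℕ.+ t C n) (sym (shift n m)) ⟩
  N C suc n ℕ.+ (n ℕ.+ n ℕ.+ suc (suc m)) C n ∎
  where
  N = suc n ℕ.+ suc n ℕ.+ m
  shift : ∀ n m → n ℕ.+ n ℕ.+ suc (suc m) ≡ suc n ℕ.+ suc n ℕ.+ m
  shift = ℕSolver.solve-∀

catalanRiordanArray : ℕ → ℕ → ℕ → ℤ
catalanRiordanArray m n k = if k ≤ᵇ n then + catalanPowerCoeff (k ℕ.* m) (n ∸ k) else + 0

module InverseSqrtAndCatalan (s c : PS) (s₀≡1 : s 0 ≡ + 1) (s²[1-4x]≈1 : (s ⊛ s) ⊛ oneMinus4x ≈ˢ one)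
                             (c≈1+xc² : c ≈ˢ (one ⊕ (X ⊛ (c ⊛ c)))) where

  xc≋x+[xc]² : X ⊛ c ≋ X ⊕ (X ⊛ c) ⊛ (X ⊛ c)
  xc≋x+[xc]² = ≋-trans (⊛-congˡ {X} (coeffwise c≈1+xc²))
    (≋-trans (⊛-distribˡ-⊕ X one (X ⊛ (c ⊛ c)))
      (⊕-cong (⊛-identityʳ X) (≋-sym (≋-trans (interchange X c X c) (⊛-assoc X X (c ⊛ c))))))

  oneMinus2xc : PS
  oneMinus2xc = one ⊕ const (- + 2) ⊛ (X ⊛ c)

  oneMinus2xc²≋oneMinus4x : oneMinus2xc ⊛ oneMinus2xc ≋ oneMinus4x
  oneMinus2xc²≋oneMinus4x = coeffwise λ n → begin
    (v ⊛ v) n                                 ≡⟨ at (⊛-distribʳ-⊕ v one b) n ⟩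
    (one ⊛ v) n + (b ⊛ v) n                   ≡⟨ cong₂ _+_ (at (⊛-identityˡ v) n)
                                                   (trans (at (⊛-distribˡ-⊕ b one b) n) (cong₂ _+_ (at (⊛-identityʳ b) n) (b²≡4q n))) ⟩
    (one n + b n) + (b n + + 4 * q n)         ≡⟨ cong (λ t → (one n + t) + (t + + 4 * q n)) (const-⊛ (- + 2) a n) ⟩
    (one n + - + 2 * a n) + (- + 2 * a n + + 4 * q n)
      ≡⟨ cong (λ t → (one n + - + 2 * t) + (- + 2 * t + + 4 * q n)) (at xc≋x+[xc]² n) ⟩
    (one n + - + 2 * (X n + q n)) + (- + 2 * (X n + q n) + + 4 * q n)
      ≡⟨ expand (one n) (X n) (q n) ⟩
    one n + - + 4 * X n                       ≡⟨ cong (λ t → one n + t) (sym (const-⊛ (- + 4) X n)) ⟩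
    oneMinus4x n                              ∎
    where
    v = oneMinus2xc
    a = X ⊛ c
    q = a ⊛ a
    b = const (- + 2) ⊛ a
    b²≡4q : ∀ n → (b ⊛ b) n ≡ + 4 * q n
    b²≡4q n = begin
      (b ⊛ b) n                               ≡⟨ at (≋-trans (interchange k a k a) (⊛-assoc k k q)) n ⟩
      (k ⊛ (k ⊛ q)) n                         ≡⟨ trans (const-⊛ (- + 2) (k ⊛ q) n) (cong (- + 2 *_) (const-⊛ (- + 2) q n)) ⟩
      - + 2 * (- + 2 * q n)                   ≡⟨ square (q n) ⟩
      + 4 * q n                               ∎
      where
      k = const (- + 2)
      square : ∀ y → - + 2 * (- + 2 * y) ≡ + 4 * y
      square = solve-∀
    expand : ∀ o x y → (o + - + 2 * (x + y)) + (- + 2 * (x + y) + + 4 * y) ≡ o + - + 4 * x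
    expand = solve-∀

  s⊛oneMinus2xc≋one : s ⊛ oneMinus2xc ≋ one
  s⊛oneMinus2xc≋one = square-root-of-one (s ⊛ oneMinus2xc)
    (≋-trans (interchange s oneMinus2xc s oneMinus2xc)
      (≋-trans (⊛-congˡ {s ⊛ s} oneMinus2xc²≋oneMinus4x) (coeffwise s²[1-4x]≈1)))
    (cong (_* + 1) s₀≡1)

  s-suc : ∀ n → s (suc n) ≡ + 2 * (s ⊛ c) n
  s-suc n = begin
    s (suc n)                                    ≡⟨ shuffle (s (suc n)) y ⟩
    (s (suc n) + - + 2 * y) + + 2 * y           ≡⟨ cong (_+ + 2 * y) sum≡0 ⟩
    + 0 + + 2 * y                                ≡⟨ ℤP.+-identityˡ _ ⟩
    + 2 * y                                      ∎
    where
    y = (s ⊛ c) n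
    shuffle : ∀ x y → x ≡ (x + - + 2 * y) + + 2 * y
    shuffle = solve-∀
    s⊛[-2xc] : (s ⊛ (const (- + 2) ⊛ (X ⊛ c))) (suc n) ≡ - + 2 * y
    s⊛[-2xc] = begin
      (s ⊛ (const (- + 2) ⊛ (X ⊛ c))) (suc n)  ≡⟨ at (x∙yz≈y∙xz s (const (- + 2)) (X ⊛ c)) (suc n) ⟩
      (const (- + 2) ⊛ (s ⊛ (X ⊛ c))) (suc n)  ≡⟨ const-⊛ (- + 2) (s ⊛ (X ⊛ c)) (suc n) ⟩
      - + 2 * (s ⊛ (X ⊛ c)) (suc n)            ≡⟨ cong (- + 2 *_) (at (x∙yz≈y∙xz s X c) (suc n)) ⟩
      - + 2 * (X ⊛ (s ⊛ c)) (suc n)            ≡⟨ cong (- + 2 *_) (X⊛-suc (s ⊛ c) n) ⟩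
      - + 2 * y                                 ∎
    sum≡0 : s (suc n) + - + 2 * y ≡ + 0
    sum≡0 = begin
      s (suc n) + - + 2 * y                                       ≡⟨ sym (cong₂ _+_ (at (⊛-identityʳ s) (suc n)) s⊛[-2xc]) ⟩
      (s ⊛ one) (suc n) + (s ⊛ (const (- + 2) ⊛ (X ⊛ c))) (suc n) ≡⟨ sym (at (⊛-distribˡ-⊕ s one (const (- + 2) ⊛ (X ⊛ c))) (suc n)) ⟩
      (s ⊛ oneMinus2xc) (suc n)                                   ≡⟨ at s⊛oneMinus2xc≋one (suc n) ⟩
      + 0                                                         ∎

  c^ˢ-suc : ∀ m → c ^ˢ suc m ≋ c ^ˢ m ⊕ X ⊛ c ^ˢ suc (suc m)
  c^ˢ-suc m = ≋-trans (⊛-congʳ {c ^ˢ m} (coeffwise c≈1+xc²))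
    (≋-trans (⊛-distribʳ-⊕ (c ^ˢ m) one (X ⊛ (c ⊛ c)))
      (⊕-cong (⊛-identityˡ (c ^ˢ m))
        (≋-trans (⊛-assoc X (c ⊛ c) (c ^ˢ m)) (⊛-congˡ {X} (⊛-assoc c c (c ^ˢ m))))))

  s⊛c^ˢ-suc : ∀ m → s ⊛ c ^ˢ suc m ≋ s ⊛ c ^ˢ m ⊕ X ⊛ (s ⊛ c ^ˢ suc (suc m))
  s⊛c^ˢ-suc m = ≋-trans (⊛-congˡ {s} (c^ˢ-suc m))
    (≋-trans (⊛-distribˡ-⊕ s (c ^ˢ m) (X ⊛ c ^ˢ suc (suc m)))
      (⊕-cong (≋-refl {s ⊛ c ^ˢ m}) (x∙yz≈y∙xz s X (c ^ˢ suc (suc m)))))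

  s⊛c^ˢ-coeff : ∀ n m → (s ⊛ c ^ˢ m) n ≡ + catalanPowerCoeff m n
  s⊛c^ˢ-coeff zero zero = trans (at (⊛-identityʳ s) 0) s₀≡1
  s⊛c^ˢ-coeff zero (suc m) =
    trans (at (s⊛c^ˢ-suc m) 0) (trans (ℤP.+-identityʳ _) (s⊛c^ˢ-coeff zero m))
  s⊛c^ˢ-coeff (suc n) zero = begin
    (s ⊛ one) (suc n)                ≡⟨ at (⊛-identityʳ s) (suc n) ⟩
    s (suc n)                        ≡⟨ s-suc n ⟩
    + 2 * (s ⊛ c) n                  ≡⟨ cong (+ 2 *_) (at (⊛-congˡ {s} (≋-sym (⊛-identityʳ c))) n) ⟩
    + 2 * (s ⊛ c ^ˢ 1) n             ≡⟨ cong (+ 2 *_) (s⊛c^ˢ-coeff n 1) ⟩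
    + 2 * + catalanPowerCoeff 1 n    ≡⟨ sym (ℤP.pos-* 2 (catalanPowerCoeff 1 n)) ⟩
    + (2 ℕ.* catalanPowerCoeff 1 n)  ≡⟨ cong +_ (sym (catalanPowerCoeff-0-suc n)) ⟩
    + catalanPowerCoeff 0 (suc n)    ∎
  s⊛c^ˢ-coeff (suc n) (suc m) = begin
    (s ⊛ c ^ˢ suc m) (suc n)
      ≡⟨ at (s⊛c^ˢ-suc m) (suc n) ⟩
    (s ⊛ c ^ˢ m) (suc n) + (X ⊛ (s ⊛ c ^ˢ suc (suc m))) (suc n)
      ≡⟨ cong₂ _+_ (s⊛c^ˢ-coeff (suc n) m)
                   (trans (X⊛-suc (s ⊛ c ^ˢ suc (suc m)) n) (s⊛c^ˢ-coeff n (suc (suc m)))) ⟩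
    + catalanPowerCoeff m (suc n) + + catalanPowerCoeff (suc (suc m)) n
      ≡⟨ cong +_ (sym (catalanPowerCoeff-suc-suc m n)) ⟩
    + catalanPowerCoeff (suc m) (suc n)
      ∎

  riordan-catalan : ∀ m n k → riordan s (X ⊛ c ^ˢ m) n k ≡ catalanRiordanArray m n k
  riordan-catalan m n k with k ℕP.≤? n
  ... | yes k≤n = begin
    riordan s (X ⊛ c ^ˢ m) n k             ≡⟨ riordan-X⊛ s (c ^ˢ m) k≤n ⟩
    (s ⊛ (c ^ˢ m) ^ˢ k) (n ∸ k)            ≡⟨ at (⊛-congˡ {s} (^ˢ-^ˢ c m k)) (n ∸ k) ⟩
    (s ⊛ c ^ˢ (k ℕ.* m)) (n ∸ k)           ≡⟨ s⊛c^ˢ-coeff (n ∸ k) (k ℕ.* m) ⟩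
    + catalanPowerCoeff (k ℕ.* m) (n ∸ k)  ≡⟨ sym (if-≤ᵇ-true k≤n) ⟩
    catalanRiordanArray m n k              ∎
  ... | no k≰n = trans (if-≤ᵇ-false k≰n) (sym (if-≤ᵇ-false k≰n))

verticalHalf-x[1+x]² : ∀ n k → verticalHalf (riordan one x1px2) n k ≡ catalanRiordanArray 2 n k
verticalHalf-x[1+x]² n k with k ℕP.≤? n
... | yes k≤n = begin
  verticalHalf (riordan one x1px2) n k   ≡⟨ if-≤ᵇ-true (ℕP.≤-trans k≤n (ℕP.m≤m+n n n)) ⟩
  riordan one x1px2 (n ℕ.+ n ∸ k) n      ≡⟨ riordan-x[1+x]² n≤2n∸k ⟩
  + ((n ℕ.* 2) C (n ℕ.+ n ∸ k ∸ n))      ≡⟨ cong₂ (λ a b → + (a C b)) 2n≡2[n∸k]+2k 2n∸k∸n≡n∸k ⟩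
  + catalanPowerCoeff (k ℕ.* 2) (n ∸ k)  ≡⟨ sym (if-≤ᵇ-true k≤n) ⟩
  catalanRiordanArray 2 n k              ∎
  where
  2n∸k≡[n∸k]+n : n ℕ.+ n ∸ k ≡ (n ∸ k) ℕ.+ n
  2n∸k≡[n∸k]+n = ℕP.+-∸-comm n k≤n
  n≤2n∸k : n ≤ n ℕ.+ n ∸ k
  n≤2n∸k = subst (n ≤_) (sym 2n∸k≡[n∸k]+n) (ℕP.m≤n+m n (n ∸ k))
  2n∸k∸n≡n∸k : n ℕ.+ n ∸ k ∸ n ≡ n ∸ k
  2n∸k∸n≡n∸k = trans (cong (_∸ n) 2n∸k≡[n∸k]+n) (ℕP.m+n∸n≡m (n ∸ k) n)
  2n≡2[n∸k]+2k : n ℕ.* 2 ≡ (n ∸ k) ℕ.+ (n ∸ k) ℕ.+ k ℕ.* 2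
  2n≡2[n∸k]+2k = trans (cong (ℕ._* 2) (sym (ℕP.m+[n∸m]≡n k≤n))) (regroup k (n ∸ k))
    where
    regroup : ∀ k d → (k ℕ.+ d) ℕ.* 2 ≡ d ℕ.+ d ℕ.+ k ℕ.* 2
    regroup = ℕSolver.solve-∀
... | no k≰n = trans above-diagonal (sym (if-≤ᵇ-false k≰n))
  where
  above-diagonal : verticalHalf (riordan one x1px2) n k ≡ + 0
  above-diagonal with k ℕP.≤? n ℕ.+ n
  ... | yes k≤2n = trans (if-≤ᵇ-true k≤2n) (if-≤ᵇ-false (ℕP.<⇒≱ 2n∸k<n))
    where
    2n∸k<n : n ℕ.+ n ∸ k < n
    2n∸k<n = subst (n ℕ.+ n ∸ k <_) (ℕP.m+n∸n≡m n n) (ℕP.∸-monoʳ-< (ℕP.≰⇒> k≰n) k≤2n)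
  ... | no k≰2n = if-≤ᵇ-false k≰2n

horizontalHalf-x[1+x]² : ∀ n k → horizontalHalf (riordan one x1px2) n k ≡ catalanRiordanArray 4 n k
horizontalHalf-x[1+x]² n k with k ℕP.≤? n
... | yes k≤n = begin
  riordan one x1px2 (n ℕ.+ n) (n ℕ.+ k)           ≡⟨ riordan-x[1+x]² (ℕP.+-monoʳ-≤ n k≤n) ⟩
  + (((n ℕ.+ k) ℕ.* 2) C (n ℕ.+ n ∸ (n ℕ.+ k)))   ≡⟨ cong₂ (λ a b → + (a C b)) 2[n+k]≡2[n∸k]+4k (ℕP.[m+n]∸[m+o]≡n∸o n n k) ⟩
  + catalanPowerCoeff (k ℕ.* 4) (n ∸ k)           ≡⟨ sym (if-≤ᵇ-true k≤n) ⟩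
  catalanRiordanArray 4 n k                       ∎
  where
  2[n+k]≡2[n∸k]+4k : (n ℕ.+ k) ℕ.* 2 ≡ (n ∸ k) ℕ.+ (n ∸ k) ℕ.+ k ℕ.* 4
  2[n+k]≡2[n∸k]+4k = trans (cong (λ t → (t ℕ.+ k) ℕ.* 2) (sym (ℕP.m+[n∸m]≡n k≤n))) (regroup k (n ∸ k))
    where
    regroup : ∀ k d → (k ℕ.+ d ℕ.+ k) ℕ.* 2 ≡ d ℕ.+ d ℕ.+ k ℕ.* 4
    regroup = ℕSolver.solve-∀
... | no k≰n = trans (if-≤ᵇ-false (k≰n ∘ ℕP.+-cancelˡ-≤ n k n)) (sym (if-≤ᵇ-false k≰n))

mainTheorem12 : (s c : PS) →
    s 0 ≡ + 1 → (s ⊛ s) ⊛ oneMinus4x ≈ˢ one →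
    c ≈ˢ (one ⊕ (X ⊛ (c ⊛ c))) →
    (∀ n k → verticalHalf (riordan one x1px2) n k ≡ riordan s (X ⊛ (c ^ˢ 2)) n k)
    × (∀ n k → horizontalHalf (riordan one x1px2) n k ≡ riordan s (X ⊛ (c ^ˢ 4)) n k)
mainTheorem12 s c s₀≡1 s²[1-4x]≈1 c≈1+xc² =
    (λ n k → trans (verticalHalf-x[1+x]² n k) (sym (riordan-catalan 2 n k)))
  , (λ n k → trans (horizontalHalf-x[1+x]² n k) (sym (riordan-catalan 4 n k)))
  where open InverseSqrtAndCatalan s c s₀≡1 s²[1-4x]≈1 c≈1+xc² using (riordan-catalan)
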